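{- Let $T$ be a tree on $t$ vertices. Then for every positive integer $n$, $\mathrm{ex}^*(n,T,2)\le 2tn$.
   Context: For a graph $H$ and positive integers $n,s$, $\mathrm{ex}^*(n,H,s)$ denotes the maximum number of edges in an $n$-vertex graph which contains no copy of $K_{s,s}$ as a subgraph and contains no induced subgraph isomorphic to $H$. (Note $K_{2,2}=C_4$.) -}

module Defs where

open import Data.Nat using (ℕ; zero; suc; _+_; _*_; _≤_; _<ᵇ_)
open import Data.Bool using (Bool; true; false; _∧_; if_then_else_)
open import Data.Fin using (Fin; zero; suc; toℕ; inject₁; fromℕ)
open import Data.List using (List; map; allFin)
open import Data.Nat.ListAction using (sum)
open import Data.Product using (Σ; ∃; _×_; _,_)
open import Relation.Binary.PropositionalEquality using (_≡_; _≢_)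
open import Relation.Nullary using (¬_)
open import Function.Definitions using (Injective)

record Graph (n : ℕ) : Set where
  field
    adj   : Fin n → Fin n → Bool
    sym   : ∀ i j → adj i j ≡ adj j i
    irrefl : ∀ i → adj i i ≡ false
open Graph public

_~[_]_ : ∀ {n} → Fin n → Graph n → Fin n → Set
u ~[ G ] v = adj G u v ≡ true

b2n : Bool → ℕ
b2n true = 1
b2n false = 0

edgeCount : ∀ {n} → Graph n → ℕ
edgeCount {n} G =
  sum (map (λ i → sum (map (λ j → b2n ((toℕ i <ᵇ toℕ j) ∧ adj G i j)) (allFin n))) (allFin n))

data Walk {n} (G : Graph n) : Fin n → Fin n → Set where
  here : ∀ {u} → Walk G u u
  step : ∀ {u w v} → u ~[ G ] w → Walk G w v → Walk G u v

Connected : ∀ {n} → Graph n → Set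
Connected G = ∀ u v → Walk G u v

-- a cycle: distinct vertices f 0, …, f (k+2) (length ≥ 3), consecutive ones
-- adjacent and the last adjacent to the first
HasCycle : ∀ {n} → Graph n → Set
HasCycle {n} G =
  Σ ℕ λ k → Σ (Fin (suc (suc (suc k))) → Fin n) λ f →
    Injective _≡_ _≡_ f
    × (∀ (i : Fin (suc (suc k))) → f (inject₁ i) ~[ G ] f (suc i))
    × (f (fromℕ (suc (suc k))) ~[ G ] f zero)

Acyclic : ∀ {n} → Graph n → Set
Acyclic G = ¬ HasCycle G

IsTree : ∀ {t} → Graph t → Set
IsTree {t} T = (1 ≤ t) × Connected T × Acyclic T

HasInduced : ∀ {n m} → Graph n → Graph m → Set
HasInduced {n} {m} G H =
  Σ (Fin m → Fin n) λ f → Injective _≡_ _≡_ f × (∀ i j → adj G (f i) (f j) ≡ adj H i j)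

HasKss : ∀ {n} → ℕ → Graph n → Set
HasKss {n} s G =
  Σ (Fin s → Fin n) λ f → Σ (Fin s → Fin n) λ g →
    Injective _≡_ _≡_ f × Injective _≡_ _≡_ g
    × (∀ i j → f i ≢ g j)
    × (∀ i j → f i ~[ G ] g j)

-- Either G is 2t-degenerate, and then it has at most 2t·n edges, or some vertex set U
-- induces a subgraph of minimum degree greater than 2t.  Then T has an induced copy in G[U],
-- grown leaf by leaf from any vertex: a new leaf v of T, attached to u, is sent to a neighbour of
-- the image of u that is neither an image nor adjacent to another image.  At most 2t neighbours
-- are excluded, because in a C₄-free graph the image of u shares at most one neighbour with each
-- other image; and as T is acyclic, u is the only neighbour of v among the vertices placed so far.
module Submission where

open import Defs hiding (sym)
open import Data.Bool using (true; false; _∧_)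
import Data.Bool as Bool
open import Data.Bool.Properties using (T-≡; ¬-not)
open import Data.Empty using (⊥; ⊥-elim)
open import Data.Fin using (Fin; zero; suc; toℕ; inject₁; fromℕ; _≟_)
import Data.Fin as Fin
open import Data.Fin.Properties using (¬∀⟶∃¬)
open import Data.List using (List; []; _∷_; _++_; length; map; filter; allFin)
open import Data.List.Properties using (length-++; length-++-sucʳ; length-map; length-tabulate; filter-++)
open import Data.List.Membership.Propositional using (_∈_; _∉_; find; lose)
open import Data.List.Membership.Propositional.Properties
  using (∈-∃++; ∈-++⁺ˡ; ∈-++⁺ʳ; ∈-++⁻; ∈-map⁺; ∈-filter⁻; ∈-allFin)
open import Data.List.Relation.Binary.Subset.Propositional using (_⊆_)
open import Data.List.Relation.Unary.All using (All; []; _∷_)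
import Data.List.Relation.Unary.All as All
open import Data.List.Relation.Unary.All.Properties using (¬Any⇒All¬; ++⁺; ++⁻ˡ; ++⁻ʳ)
open import Data.List.Relation.Unary.Any using (here; there; any?)
open import Data.List.Relation.Unary.AllPairs using (AllPairs; []; _∷_)
open import Data.List.Relation.Unary.AllPairs.Properties using (tabulate⁺-<)
open import Data.List.Relation.Unary.Unique.Propositional using (Unique)
open import Data.List.Relation.Unary.Unique.Propositional.Properties using (allFin⁺; filter⁺)
open import Data.Nat using (ℕ; zero; suc; _+_; _*_; _∸_; _≤_; _<_; _≤?_; _<ᵇ_; z≤n; s≤s; z<s)
open import Data.Nat.ListAction using (sum)
open import Data.Nat.Properties hiding (_≟_)
open import Data.Nat.Tactic.RingSolver using (solve-∀)
open import Data.Product using (Σ; ∃-syntax; _×_; _,_; proj₂)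
open import Data.Sum using (_⊎_; inj₁; inj₂)
open import Data.Vec.Functional using (updateAt)
open import Data.Vec.Functional.Properties using (updateAt-updates; updateAt-minimal)
open import Function using (_∘_; const)
open import Function.Bundles using (Equivalence)
open import Function.Definitions using (Injective)
open import Relation.Binary.PropositionalEquality
open import Relation.Nullary using (¬_; Dec; yes; no; ¬?; contradiction)
open import Relation.Nullary.Decidable using (_×-dec_; decidable-stable)

-- Counting elements of lists

module _ {A : Set} where

  ∈-++-∷⁻ : ∀ as {x y : A} {bs} → y ∈ as ++ x ∷ bs → y ≢ x → y ∈ as ++ bs
  ∈-++-∷⁻ as y∈ y≢x with ∈-++⁻ as y∈
  ... | inj₁ y∈as         = ∈-++⁺ˡ y∈as
  ... | inj₂ (here y≡x)   = contradiction y≡x y≢x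
  ... | inj₂ (there y∈bs) = ∈-++⁺ʳ as y∈bs

  Unique-++-∷⁻ : ∀ as {x : A} {bs} → Unique (as ++ x ∷ bs) → Unique (as ++ bs)
  Unique-++-∷⁻ []       (_ ∷ u)    = u
  Unique-++-∷⁻ (a ∷ as) (a∉ ∷ u) =
    ++⁺ (++⁻ˡ as a∉) (All.tail (++⁻ʳ as a∉)) ∷ Unique-++-∷⁻ as u

module _ {A B : Set} (R : A → B → Set) where

  cover⇒length≤ : ∀ {xs : List A} {ys : List B} → Unique ys →
    (∀ {y} → y ∈ ys → ∃[ x ] x ∈ xs × R x y) →
    (∀ {x y y′} → y ∈ ys → y′ ∈ ys → R x y → R x y′ → y ≡ y′) →
    length ys ≤ length xs
  cover⇒length≤ {ys = []} _ _ _ = z≤n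
  cover⇒length≤ {xs} {y ∷ ys} (y∉ys ∷ ys-unique) covered functional
    with x , x∈xs , Rxy ← covered (here refl)
    with as , bs , refl ← ∈-∃++ x∈xs =
      subst (suc (length ys) ≤_) (sym (length-++-sucʳ as x bs))
        (s≤s (cover⇒length≤ ys-unique covered′ (λ p q → functional (there p) (there q))))
    where
      covered′ : ∀ {y′} → y′ ∈ ys → ∃[ x′ ] x′ ∈ as ++ bs × R x′ y′
      covered′ y′∈ys with x′ , x′∈xs , Rx′y′ ← covered (there y′∈ys) =
        x′ , ∈-++-∷⁻ as x′∈xs x′≢x , Rx′y′
        where
          x′≢x : x′ ≢ x
          x′≢x refl =
            All.lookup y∉ys y′∈ys (functional (here refl) (there y′∈ys) Rxy Rx′y′)

⊆⇒length≤ : ∀ {A : Set} {xs ys : List A} → Unique ys → ys ⊆ xs → length ys ≤ length xs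
⊆⇒length≤ ys-unique ys⊆xs =
  cover⇒length≤ _≡_ ys-unique (λ y∈ → _ , ys⊆xs y∈ , refl) (λ { _ _ refl refl → refl })

module _ {t : ℕ} where

  open import Data.List.Membership.DecPropositional (_≟_ {t}) using (_∈?_)

  length-allFin : length (allFin t) ≡ t
  length-allFin = length-tabulate (λ i → i)

  Unique⇒length≤ : {S : List (Fin t)} → Unique S → length S ≤ t
  Unique⇒length≤ {S} S-unique =
    subst (length S ≤_) length-allFin (⊆⇒length≤ S-unique (λ {x} _ → ∈-allFin x))

  length<⇒∃∉ : (S : List (Fin t)) → length S < t → ∃[ a ] a ∉ S
  length<⇒∃∉ S len<t = ¬∀⟶∃¬ t (_∈ S) (_∈? S) λ all∈S →
    <⇒≱ len<t (subst (_≤ length S) length-allFin (⊆⇒length≤ (allFin⁺ t) (λ {a} _ → all∈S a)))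

  Unique∧length≡⇒∈ : {S : List (Fin t)} → Unique S → length S ≡ t → ∀ a → a ∈ S
  Unique∧length≡⇒∈ {S} S-unique len≡t a with a ∈? S
  ... | yes a∈S = a∈S
  ... | no  a∉S = contradiction
    (subst (λ m → suc m ≤ t) len≡t (Unique⇒length≤ (¬Any⇒All¬ S a∉S ∷ S-unique)))
    1+n≰n

<ᵇ-true : ∀ {m k} → m < k → (m <ᵇ k) ≡ true
<ᵇ-true m<k = Equivalence.to T-≡ (<⇒<ᵇ m<k)

<ᵇ-false : ∀ {m k} → k ≤ m → (m <ᵇ k) ≡ false
<ᵇ-false {m} {k} k≤m = ¬-not λ m<ᵇk → ≤⇒≯ k≤m (<ᵇ⇒< m k (Equivalence.from T-≡ m<ᵇk))

-- Walks, paths and cycles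

module _ {n : ℕ} {G : Graph n} where

  open import Data.List.Membership.DecPropositional (_≟_ {n}) using (_∈?_)

  ~-sym : ∀ {x y} → x ~[ G ] y → y ~[ G ] x
  ~-sym {x} {y} xy = trans (Graph.sym G y x) xy

  ~-irrefl : ∀ {x y} → x ~[ G ] y → x ≢ y
  ~-irrefl {x} xx refl with () ← trans (sym xx) (irrefl G x)

  vertices : ∀ {a b} → Walk G a b → List (Fin n)
  vertices {a} here       = a ∷ []
  vertices {a} (step _ w) = a ∷ vertices w

  start∈vertices : ∀ {a b} (w : Walk G a b) → a ∈ vertices w
  start∈vertices here       = here refl
  start∈vertices (step _ _) = here refl

  _++ʷ_ : ∀ {a b c} → Walk G a b → Walk G b c → Walk G a c
  here     ++ʷ w₂ = w₂
  step e w ++ʷ w₂ = step e (w ++ʷ w₂)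

  vertices-++ʷ : ∀ {a b c} (w₁ : Walk G a b) (w₂ : Walk G b c) →
    vertices (w₁ ++ʷ w₂) ⊆ vertices w₁ ++ vertices w₂
  vertices-++ʷ here       w₂ = there
  vertices-++ʷ (step e w) w₂ (here refl) = here refl
  vertices-++ʷ (step e w) w₂ (there q)   = there (vertices-++ʷ w w₂ q)

  reverse : ∀ {a b} → Walk G a b → Walk G b a
  reverse here       = here
  reverse (step e w) = reverse w ++ʷ step (~-sym e) here

  vertices-reverse : ∀ {a b} (w : Walk G a b) → vertices (reverse w) ⊆ vertices w
  vertices-reverse here q = q
  vertices-reverse (step e w) q with ∈-++⁻ (vertices (reverse w)) (vertices-++ʷ (reverse w) _ q)
  ... | inj₁ q′                 = there (vertices-reverse w q′)
  ... | inj₂ (here refl)         = there (start∈vertices w)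
  ... | inj₂ (there (here refl)) = here refl

  PathWithin : Fin n → Fin n → List (Fin n) → Set
  PathWithin a b V = Σ (Walk G a b) λ p → Unique (vertices p) × vertices p ⊆ V

  suffix : ∀ {x a b} (p : Walk G a b) → Unique (vertices p) → x ∈ vertices p →
    PathWithin x b (vertices p)
  suffix here       u (here refl) = here , u , λ q → q
  suffix (step e p) u (here refl) = step e p , u , λ q → q
  suffix (step e p) (_ ∷ u) (there x∈p) with p′ , p′-unique , p′⊆p ← suffix p u x∈p =
    p′ , p′-unique , there ∘ p′⊆p

  shortcut : ∀ {a b} (w : Walk G a b) → PathWithin a b (vertices w)
  shortcut here = here , [] ∷ [] , λ q → q
  shortcut {a} (step e w) with shortcut w
  ... | p , p-unique , p⊆w with a ∈? vertices p
  ...   | yes a∈p = let p′ , p′-unique , p′⊆p = suffix p p-unique a∈p in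
    p′ , p′-unique , there ∘ p⊆w ∘ p′⊆p
  ...   | no  a∉p = step e p , ¬Any⇒All¬ _ a∉p ∷ p-unique , λ
    { (here refl) → here refl
    ; (there q)   → there (p⊆w q) }

  lengthʷ : ∀ {a b} → Walk G a b → ℕ
  lengthʷ here       = zero
  lengthʷ (step _ w) = suc (lengthʷ w)

  vertex : ∀ {a b} (w : Walk G a b) → Fin (suc (lengthʷ w)) → Fin n
  vertex {a} here       zero    = a
  vertex {a} (step _ w) zero    = a
  vertex     (step _ w) (suc i) = vertex w i

  vertex∈vertices : ∀ {a b} (w : Walk G a b) i → vertex w i ∈ vertices w
  vertex∈vertices here       zero    = here refl
  vertex∈vertices (step _ w) zero    = here refl
  vertex∈vertices (step _ w) (suc i) = there (vertex∈vertices w i)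

  vertex-injective : ∀ {a b} (w : Walk G a b) → Unique (vertices w) → Injective _≡_ _≡_ (vertex w)
  vertex-injective here       _ {zero} {zero} _ = refl
  vertex-injective (step _ w) _ {zero} {zero} _ = refl
  vertex-injective (step _ w) (a∉w ∷ _) {zero} {suc j} a≡ =
    contradiction a≡ (All.lookup a∉w (vertex∈vertices w j))
  vertex-injective (step _ w) (a∉w ∷ _) {suc i} {zero} ≡a =
    contradiction (sym ≡a) (All.lookup a∉w (vertex∈vertices w i))
  vertex-injective (step _ w) (_ ∷ u) {suc i} {suc j} eq = cong suc (vertex-injective w u eq)

  vertex-zero : ∀ {a b} (w : Walk G a b) → vertex w zero ≡ a
  vertex-zero here       = refl
  vertex-zero (step _ w) = refl

  vertex-last : ∀ {a b} (w : Walk G a b) → vertex w (fromℕ (lengthʷ w)) ≡ b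
  vertex-last here       = refl
  vertex-last (step _ w) = vertex-last w

  vertex-step : ∀ {a b} (w : Walk G a b) (i : Fin (lengthʷ w)) →
    vertex w (inject₁ i) ~[ G ] vertex w (suc i)
  vertex-step (step e w) zero    = subst (_ ~[ G ]_) (sym (vertex-zero w)) e
  vertex-step (step _ w) (suc i) = vertex-step w i

  path⇒cycle : ∀ {a c d b} (e₁ : a ~[ G ] c) (e₂ : c ~[ G ] d) (p : Walk G d b) →
    Unique (vertices (step e₁ (step e₂ p))) → b ~[ G ] a → HasCycle G
  path⇒cycle e₁ e₂ p unique ba =
    lengthʷ p , vertex C , vertex-injective C unique , vertex-step C ,
    subst (_~[ G ] _) (sym (vertex-last p)) ba
    where C = step e₁ (step e₂ p)

  acyclic⇒¬apex : Acyclic G → ∀ {u s v} (w : Walk G u s) → u ≢ s → v ∉ vertices w →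
    v ~[ G ] u → s ~[ G ] v → ⊥
  acyclic⇒¬apex acyclic w u≢s v∉w vu sv with shortcut w
  ... | here , _ , _ = u≢s refl
  ... | step e p , p-unique , p⊆w =
    acyclic (path⇒cycle vu e p (¬Any⇒All¬ _ (v∉w ∘ p⊆w) ∷ p-unique) sv)

  ReachableWithin : List (Fin n) → Fin n → Set
  ReachableWithin S r = ∀ {s} → s ∈ S → Σ (Walk G s r) λ w → vertices w ⊆ S

  ReachableWithin-∷ : ∀ {S r u v} → ReachableWithin S r → u ∈ S → v ~[ G ] u →
    ReachableWithin (v ∷ S) r
  ReachableWithin-∷ reach u∈S vu (here refl) with w , w⊆S ← reach u∈S = step vu w , λ
    { (here refl) → here refl
    ; (there q)   → there (w⊆S q) }
  ReachableWithin-∷ reach u∈S vu (there s∈S) with w , w⊆S ← reach s∈S = w , there ∘ w⊆S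

  acyclic⇒unique-neighbour : Acyclic G → ∀ {S r u s v} → ReachableWithin S r → v ∉ S →
    u ∈ S → s ∈ S → u ~[ G ] v → s ~[ G ] v → s ≡ u
  acyclic⇒unique-neighbour acyclic {S} {u = u} {s} reach v∉S u∈S s∈S uv sv with s ≟ u
  ... | yes s≡u = s≡u
  ... | no  s≢u with w₁ , w₁⊆S ← reach u∈S | w₂ , w₂⊆S ← reach s∈S =
    ⊥-elim (acyclic⇒¬apex acyclic (w₁ ++ʷ reverse w₂) (s≢u ∘ sym) (v∉S ∘ inside)
      (~-sym uv) sv)
    where
      inside : vertices (w₁ ++ʷ reverse w₂) ⊆ S
      inside q with ∈-++⁻ (vertices w₁) (vertices-++ʷ w₁ (reverse w₂) q)
      ... | inj₁ q₁ = w₁⊆S q₁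
      ... | inj₂ q₂ = w₂⊆S (vertices-reverse w₂ q₂)

  boundary-edge : ∀ {S a b} → Walk G a b → a ∈ S → b ∉ S →
    ∃[ u ] ∃[ v ] u ∈ S × v ∉ S × u ~[ G ] v
  boundary-edge here       a∈S a∉S = contradiction a∈S a∉S
  boundary-edge {S} (step {w = c} e w) a∈S b∉S with c ∈? S
  ... | yes c∈S = boundary-edge w c∈S b∉S
  ... | no  c∉S = _ , c , a∈S , c∉S , e

-- Degrees and degeneracy

module _ {n : ℕ} (G : Graph n) where

  neighbours : Fin n → List (Fin n) → List (Fin n)
  neighbours x = filter (λ y → adj G x y Bool.≟ true)

  ∈-neighbours⁻ : ∀ {x w} U → w ∈ neighbours x U → w ∈ U × x ~[ G ] w
  ∈-neighbours⁻ U = ∈-filter⁻ _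

  degree : Fin n → List (Fin n) → ℕ
  degree x U = length (neighbours x U)

  edges : List (Fin n) → ℕ
  edges []      = 0
  edges (x ∷ U) = degree x U + edges U

  degree-∷ : ∀ x y U → degree x (y ∷ U) ≡ b2n (adj G x y) + degree x U
  degree-∷ x y U with adj G x y
  ... | true  = refl
  ... | false = refl

  degree-++ : ∀ x U V → degree x (U ++ V) ≡ degree x U + degree x V
  degree-++ x U V = trans (cong length (filter-++ _ U V)) (length-++ (neighbours x U))

  degree-++-∷ : ∀ x as bs → degree x (as ++ x ∷ bs) ≡ degree x (as ++ bs)
  degree-++-∷ x as bs
    rewrite degree-++ x as (x ∷ bs) | degree-++ x as bs | degree-∷ x x bs | irrefl G x = refl

  edges-++-∷ : ∀ x as bs → edges (as ++ x ∷ bs) ≡ degree x (as ++ bs) + edges (as ++ bs)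
  edges-++-∷ x []       bs = refl
  edges-++-∷ x (a ∷ as) bs
    rewrite edges-++-∷ x as bs | degree-++ a as (x ∷ bs) | degree-++ a as bs
          | degree-∷ a x bs | degree-∷ x a (as ++ bs) | Graph.sym G a x =
      +-rearrange (b2n (adj G x a)) (degree a as) (degree a bs)
        (degree x (as ++ bs)) (edges (as ++ bs))
    where
      +-rearrange : ∀ p q r s u → q + (p + r) + (s + u) ≡ p + s + (q + r + u)
      +-rearrange = solve-∀

  Degenerate : ℕ → Set
  Degenerate D = ∀ {U} → Unique U → U ≢ [] → ∃[ x ] x ∈ U × degree x U ≤ D

  Degenerate⇒edges≤ : ∀ {D} → Degenerate D → ∀ {U} → Unique U → edges U ≤ D * length U
  Degenerate⇒edges≤ {D} degenerate {U} = go (length U) refl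
    where
      go : ∀ m {U} → length U ≡ m → Unique U → edges U ≤ D * m
      go zero    {[]} _ _ = z≤n
      go (suc m) {U} len U-unique
        with x , x∈U , deg≤D ← degenerate U-unique (λ { refl → 0≢1+n len })
        with as , bs , refl ← ∈-∃++ x∈U = begin
          edges (as ++ x ∷ bs)                    ≡⟨ edges-++-∷ x as bs ⟩
          degree x (as ++ bs) + edges (as ++ bs)  ≤⟨ +-mono-≤ deg′≤D (go m len′ unique′) ⟩
          D + D * m                               ≡⟨ *-suc D m ⟨
          D * suc m                               ∎
        where
          open ≤-Reasoning
          deg′≤D : degree x (as ++ bs) ≤ D
          deg′≤D = subst (_≤ D) (degree-++-∷ x as bs) deg≤D
          len′ : length (as ++ bs) ≡ m
          len′ = suc-injective (trans (sym (length-++-sucʳ as x bs)) len)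
          unique′ : Unique (as ++ bs)
          unique′ = Unique-++-∷⁻ as U-unique

  orderedEdge : Fin n → Fin n → ℕ
  orderedEdge i j = b2n ((toℕ i <ᵇ toℕ j) ∧ adj G i j)

  orderedEdges : List (Fin n) → List (Fin n) → ℕ
  orderedEdges L M = sum (map (λ i → sum (map (orderedEdge i) M)) L)

  orderedEdges-row : ∀ x {M} → All (x Fin.<_) M → sum (map (orderedEdge x) M) ≡ degree x M
  orderedEdges-row x []                   = refl
  orderedEdges-row x {j ∷ M} (x<j ∷ x<M) rewrite <ᵇ-true x<j =
    trans (cong (b2n (adj G x j) +_) (orderedEdges-row x x<M)) (sym (degree-∷ x j M))

  orderedEdges-column : ∀ x M {L} → All (x Fin.<_) L → orderedEdges L (x ∷ M) ≡ orderedEdges L M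
  orderedEdges-column x M []                   = refl
  orderedEdges-column x M {i ∷ L} (x<i ∷ x<L) rewrite <ᵇ-false (<⇒≤ x<i) =
    cong (sum (map (orderedEdge i) M) +_) (orderedEdges-column x M x<L)

  orderedEdges-sorted : ∀ {L} → AllPairs Fin._<_ L → orderedEdges L L ≡ edges L
  orderedEdges-sorted []                         = refl
  orderedEdges-sorted {x ∷ L} (x<L ∷ L-sorted)
    rewrite <ᵇ-false (≤-refl {toℕ x}) | orderedEdges-row x x<L | orderedEdges-column x L x<L
          | orderedEdges-sorted L-sorted = refl

  edgeCount≡edges : edgeCount G ≡ edges (allFin n)
  edgeCount≡edges = orderedEdges-sorted (tabulate⁺-< (λ i<j → i<j))

-- C₄-free graphs

pair : ∀ {A : Set} → A → A → Fin 2 → A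
pair a b zero       = a
pair a b (suc zero) = b

pair-injective : ∀ {A : Set} {a b : A} → a ≢ b → Injective _≡_ _≡_ (pair a b)
pair-injective a≢b {zero}     {zero}     _   = refl
pair-injective a≢b {zero}     {suc zero} a≡b = contradiction a≡b a≢b
pair-injective a≢b {suc zero} {zero}     b≡a = contradiction (sym b≡a) a≢b
pair-injective a≢b {suc zero} {suc zero} _   = refl

module _ {n : ℕ} (G : Graph n) (C₄-free : ¬ HasKss 2 G) where

  common-neighbour-unique : ∀ {x z y y′} → x ≢ z →
    x ~[ G ] y → x ~[ G ] y′ → z ~[ G ] y → z ~[ G ] y′ → y ≡ y′
  common-neighbour-unique {x} {z} {y} {y′} x≢z xy xy′ zy zy′ with y ≟ y′
  ... | yes y≡y′ = y≡y′
  ... | no  y≢y′ = contradiction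
    ( pair x z , pair y y′
    , (λ {_} {_} → pair-injective x≢z) , (λ {_} {_} → pair-injective y≢y′)
    , (λ i j → ~-irrefl {G = G} (edge i j)) , edge )
    C₄-free
    where
      edge : ∀ i j → pair x z i ~[ G ] pair y y′ j
      edge zero       zero       = xy
      edge zero       (suc zero) = xy′
      edge (suc zero) zero       = zy
      edge (suc zero) (suc zero) = zy′

  module _ (x : Fin n) (X : List (Fin n)) where

    -- w is blocked if w ∈ X (witness inj₁ w) or w is adjacent to some y ∈ X other than x
    -- (witness inj₂ y); by C₄-freeness each witness blocks at most one neighbour of x.
    private
      Blocks : Fin n ⊎ Fin n → Fin n → Set
      Blocks (inj₁ y) w = y ≡ w
      Blocks (inj₂ y) w = y ≢ x × y ~[ G ] w

      blocks? : ∀ w z → Dec (Blocks z w)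
      blocks? w (inj₁ y) = y ≟ w
      blocks? w (inj₂ y) = ¬? (y ≟ x) ×-dec (adj G y w Bool.≟ true)

      witnesses : List (Fin n ⊎ Fin n)
      witnesses = map inj₁ X ++ map inj₂ X

    private-neighbour : ∀ {U} → Unique U → 2 * length X < degree G x U →
      ∃[ w ] w ∈ U × x ~[ G ] w × w ∉ X × (∀ {y} → y ∈ X → y ≢ x → ¬ y ~[ G ] w)
    private-neighbour {U} U-unique X-small
      with any? (λ w → ¬? (any? (blocks? w) witnesses)) (neighbours G x U)
    ... | yes some with w , w∈N , unblocked ← find some with w∈U , xw ← ∈-neighbours⁻ G U w∈N =
      w , w∈U , xw ,
      (λ w∈X → unblocked (lose (∈-++⁺ˡ (∈-map⁺ inj₁ w∈X)) refl)) ,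
      (λ y∈X y≢x yw → unblocked (lose (∈-++⁺ʳ (map inj₁ X) (∈-map⁺ inj₂ y∈X)) (y≢x , yw)))
    ... | no none = contradiction X-small (≤⇒≯ (begin
      degree G x U         ≤⟨ cover⇒length≤ Blocks (filter⁺ _ U-unique) blocked functional ⟩
      length witnesses     ≡⟨ length-++ (map inj₁ X) ⟩
      length (map inj₁ X) + length (map inj₂ X)
                           ≡⟨ cong₂ _+_ (length-map inj₁ X) (length-map inj₂ X) ⟩
      length X + length X  ≡⟨ cong (length X +_) (+-identityʳ (length X)) ⟨
      2 * length X         ∎))
      where
        open ≤-Reasoning
        blocked : ∀ {w} → w ∈ neighbours G x U → ∃[ z ] z ∈ witnesses × Blocks z w
        blocked {w} w∈N = find (decidable-stable (any? (blocks? w) witnesses) (none ∘ lose w∈N))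
        functional : ∀ {z w w′} → w ∈ neighbours G x U → w′ ∈ neighbours G x U →
          Blocks z w → Blocks z w′ → w ≡ w′
        functional {inj₁ y} _ _ y≡w y≡w′ = trans (sym y≡w) y≡w′
        functional {inj₂ y} w∈N w′∈N (y≢x , yw) (_ , yw′) =
          common-neighbour-unique (y≢x ∘ sym)
            (proj₂ (∈-neighbours⁻ G U w∈N)) (proj₂ (∈-neighbours⁻ G U w′∈N)) yw yw′

-- Growing an induced copy of a tree

module _ {t n : ℕ} (T : Graph t) (G : Graph n) (U : List (Fin n)) where

  record InducedCopy (S : List (Fin t)) (φ : Fin t → Fin n) : Set where
    field
      into      : ∀ {a} → a ∈ S → φ a ∈ U
      injective : ∀ {a b} → a ∈ S → b ∈ S → φ a ≡ φ b → a ≡ b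
      induced   : ∀ {a b} → a ∈ S → b ∈ S → adj G (φ a) (φ b) ≡ adj T a b

  InducedCopy-singleton : ∀ {r x} → x ∈ U → InducedCopy (r ∷ []) (const x)
  InducedCopy-singleton {r} {x} x∈U = record
    { into      = λ { (here refl) → x∈U }
    ; injective = λ { (here refl) (here refl) _ → refl }
    ; induced   = λ { (here refl) (here refl) → trans (irrefl G x) (sym (irrefl T r)) }
    }

  InducedCopy-∷ : ∀ {S φ v w} → InducedCopy S φ → v ∉ S → w ∈ U → w ∉ map φ S →
    (∀ {s} → s ∈ S → adj G (φ s) w ≡ adj T s v) →
    InducedCopy (v ∷ S) (updateAt φ v (const w))
  InducedCopy-∷ {S} {φ} {v} {w} copy v∉S w∈U w∉φS edge = record
    { into = into′ ; injective = injective′ ; induced = induced′ }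
    where
      open InducedCopy copy
      ψ : Fin t → Fin n
      ψ = updateAt φ v (const w)
      ψ-new : ψ v ≡ w
      ψ-new = updateAt-updates v φ
      ψ-old : ∀ {a} → a ∈ S → ψ a ≡ φ a
      ψ-old {a} a∈S = updateAt-minimal a v φ λ { refl → v∉S a∈S }
      fresh : ∀ {a} → a ∈ S → ψ a ≢ ψ v
      fresh a∈S ψa≡ψv =
        w∉φS (subst (_∈ map φ S) (trans (sym (ψ-old a∈S)) (trans ψa≡ψv ψ-new)) (∈-map⁺ φ a∈S))

      into′ : ∀ {a} → a ∈ v ∷ S → ψ a ∈ U
      into′ (here refl) = subst (_∈ U) (sym ψ-new) w∈U
      into′ (there a∈S) = subst (_∈ U) (sym (ψ-old a∈S)) (into a∈S)

      injective′ : ∀ {a b} → a ∈ v ∷ S → b ∈ v ∷ S → ψ a ≡ ψ b → a ≡ b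
      injective′ (here refl) (here refl) _     = refl
      injective′ (here refl) (there b∈S) ψv≡ψb = contradiction (sym ψv≡ψb) (fresh b∈S)
      injective′ (there a∈S) (here refl) ψa≡ψv = contradiction ψa≡ψv (fresh a∈S)
      injective′ (there a∈S) (there b∈S) ψa≡ψb =
        injective a∈S b∈S (trans (sym (ψ-old a∈S)) (trans ψa≡ψb (ψ-old b∈S)))

      induced′ : ∀ {a b} → a ∈ v ∷ S → b ∈ v ∷ S → adj G (ψ a) (ψ b) ≡ adj T a b
      induced′ (here refl) (here refl) rewrite ψ-new = trans (irrefl G w) (sym (irrefl T v))
      induced′ {b = b} (here refl) (there b∈S) rewrite ψ-new | ψ-old b∈S =
        trans (Graph.sym G w (φ b)) (trans (edge b∈S) (Graph.sym T b v))
      induced′ (there a∈S) (here refl) rewrite ψ-new | ψ-old a∈S = edge a∈S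
      induced′ (there a∈S) (there b∈S) rewrite ψ-old a∈S | ψ-old b∈S = induced a∈S b∈S

  InducedCopy⇒HasInduced : ∀ {S φ} → InducedCopy S φ → (∀ a → a ∈ S) → HasInduced G T
  InducedCopy⇒HasInduced {φ = φ} copy all∈S =
    φ , (λ {a} {b} → injective (all∈S a) (all∈S b)) , λ a b → induced (all∈S a) (all∈S b)
    where open InducedCopy copy

module _ {t n : ℕ} (T : Graph t) (G : Graph n) (T-connected : Connected T) (T-acyclic : Acyclic T)
         (C₄-free : ¬ HasKss 2 G) {U : List (Fin n)} (U-unique : Unique U)
         (U-dense : ∀ {x} → x ∈ U → 2 * t < degree G x U) where

  record PartialCopy (k : ℕ) : Set where
    field
      S           : List (Fin t)
      S-unique    : Unique S
      S-length    : length S ≡ k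
      root        : Fin t
      root∈S      : root ∈ S
      S-connected : ReachableWithin {G = T} S root
      φ           : Fin t → Fin n
      φ-copy      : InducedCopy T G U S φ

  PartialCopy-singleton : Fin t → ∀ {x} → x ∈ U → PartialCopy 1
  PartialCopy-singleton r x∈U = record
    { S           = r ∷ []
    ; S-unique    = [] ∷ []
    ; S-length    = refl
    ; root        = r
    ; root∈S      = here refl
    ; S-connected = λ { (here refl) → here , λ { (here refl) → here refl } }
    ; φ           = const _
    ; φ-copy      = InducedCopy-singleton T G U x∈U
    }

  module _ {k} (c : PartialCopy k) where
    open PartialCopy c
    open InducedCopy φ-copy

    few-images : ∀ {u} → u ∈ S → k < t → 2 * length (map φ S) < degree G (φ u) U
    few-images u∈S k<t = begin-strict
      2 * length (map φ S) ≡⟨ cong (2 *_) (trans (length-map φ S) S-length) ⟩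
      2 * k                ≤⟨ *-monoʳ-≤ 2 (<⇒≤ k<t) ⟩
      2 * t                <⟨ U-dense (into u∈S) ⟩
      degree G (φ _) U     ∎
      where open ≤-Reasoning

    grow : k < t → PartialCopy (suc k)
    grow k<t
      with a , a∉S ← length<⇒∃∉ S (subst (_< t) (sym S-length) k<t)
      with u , v , u∈S , v∉S , uv ← boundary-edge (T-connected root a) root∈S a∉S
      with w , w∈U , φu~w , w∉φS , w-private ←
             private-neighbour G C₄-free (φ u) (map φ S) U-unique (few-images u∈S k<t)
      = record
        { S           = v ∷ S
        ; S-unique    = ¬Any⇒All¬ S v∉S ∷ S-unique
        ; S-length    = cong suc S-length
        ; root        = root
        ; root∈S      = there root∈S
        ; S-connected = ReachableWithin-∷ S-connected u∈S (~-sym {G = T} uv)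
        ; φ           = updateAt φ v (const w)
        ; φ-copy      = InducedCopy-∷ T G U φ-copy v∉S w∈U w∉φS matches
        }
      where
        matches : ∀ {s} → s ∈ S → adj G (φ s) w ≡ adj T s v
        matches {s} s∈S with s ≟ u
        ... | yes refl = trans φu~w (sym uv)
        ... | no  s≢u  = trans
          (¬-not (w-private (∈-map⁺ φ s∈S) (s≢u ∘ injective s∈S u∈S)))
          (sym (¬-not (s≢u ∘ acyclic⇒unique-neighbour {G = T} T-acyclic S-connected
                                                          v∉S u∈S s∈S uv)))

  grow-by : ∀ d {k} → PartialCopy k → d + k ≡ t → PartialCopy t
  grow-by zero    c refl  = c
  grow-by (suc d) {k} c d+k≡t =
    grow-by d (grow c (subst (k <_) d+k≡t (m<n+m k z<s))) (trans (+-suc d k) d+k≡t)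

  dense⇒HasInduced : 1 ≤ t → ∀ {x} → x ∈ U → HasInduced G T
  dense⇒HasInduced 0<t x∈U =
    InducedCopy⇒HasInduced T G U φ-copy (Unique∧length≡⇒∈ S-unique S-length)
    where
      open PartialCopy
        (grow-by (t ∸ 1) (PartialCopy-singleton (Fin.fromℕ< 0<t) x∈U) (m∸n+n≡m 0<t))

¬HasInduced⇒Degenerate : ∀ {t n} (T : Graph t) (G : Graph n) → IsTree T →
  ¬ HasKss 2 G → ¬ HasInduced G T → Degenerate G (2 * t)
¬HasInduced⇒Degenerate T G tree C₄-free no-copy {[]} _ []≢[] = contradiction refl []≢[]
¬HasInduced⇒Degenerate {t} T G (0<t , T-connected , T-acyclic) C₄-free no-copy
  {U@(_ ∷ _)} U-unique _ with any? (λ x → degree G x U ≤? 2 * t) U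
... | yes low  = find low
... | no  none = contradiction
  (dense⇒HasInduced T G T-connected T-acyclic C₄-free U-unique
    (λ x∈U → ≰⇒> (none ∘ lose x∈U)) 0<t (here refl))
  no-copy

proposition3p2 : ∀ {t} (T : Graph t) → IsTree T →
    ∀ (n : ℕ) → 1 ≤ n → (G : Graph n) → ¬ HasKss 2 G → ¬ HasInduced G T →
    edgeCount G ≤ 2 * t * n
proposition3p2 {t} T tree n _ G C₄-free no-copy = begin
  edgeCount G               ≡⟨ edgeCount≡edges G ⟩
  edges G (allFin n)        ≤⟨ Degenerate⇒edges≤ G degenerate (allFin⁺ n) ⟩
  2 * t * length (allFin n) ≡⟨ cong (2 * t *_) length-allFin ⟩
  2 * t * n                 ∎
  where
    open ≤-Reasoning
    degenerate : Degenerate G (2 * t)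
    degenerate = ¬HasInduced⇒Degenerate T G tree C₄-free no-copy
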